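{- Let $G$ be a finite simple graph with $n\ge 1$ vertices and $m$ edges. Then \[NK(G^{ -- }) \le (n-2)^{m}\left[(n+m-1)-\frac{4m}{n}\right]^{n},\] with equality if and only if $G$ is a regular graph.
   Context: For a graph $H$, $NK(H)=\prod_{v\in V(H)} d_H(v)$ (Narumi-Katayama index). For $a,b\in\{+,-\}$ the transformation graph $G^{ab}$ has vertex set $V(G)\cup E(G)$ (disjoint union), with adjacency: two vertices $u,v\in V(G)$ are adjacent in $G^{ab}$ iff they are adjacent in $G$ (when $a=+$), resp. not adjacent in $G$ (when $a=-$); a vertex $u\in V(G)$ and an edge $e\in E(G)$ are adjacent in $G^{ab}$ iff $u$ is incident to $e$ (when $b=+$), resp. not incident (when $b=-$); two elements of $E(G)$ are never adjacent in $G^{ab}$. Thus in $G^{ -- }$ a vertex $u$ of $G$ has degree $n+m-1-2d_G(u)$ and each edge of $G$ has degree $n-2$. -}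

module Defs where

open import Data.Nat using (ℕ)
open import Data.Fin using (Fin; _<_; _≟_)
open import Data.Fin.Properties using (_<?_)
open import Data.Bool using (Bool; true; false; not; _∧_)
open import Data.List using (List; allFin; filter; length; map; _++_; concatMap; [])
open import Data.Nat.ListAction using (product)
open import Data.Product using (_×_; _,_; ∃)
open import Relation.Binary using (Rel)
open import Relation.Binary.PropositionalEquality using (_≡_)
open import Relation.Nullary using (¬_; Dec; does)
open import Relation.Nullary.Decidable using (⌊_⌋)

record SimpleGraph (n : ℕ) : Set₁ where
  field
    Adj       : Rel (Fin n) _
    adj?      : ∀ u v → Dec (Adj u v)
    symmetric : ∀ {u v} → Adj u v → Adj v u
    irreflexive : ∀ {u} → ¬ Adj u u

module _ {n : ℕ} (G : SimpleGraph n) where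
  open SimpleGraph G

  adjB : Fin n → Fin n → Bool
  adjB u v = does (adj? u v)

  degree : Fin n → ℕ
  degree u = length (filter (λ v → adj? u v) (allFin n))

  -- the edge set of G: each edge {i,j} listed once as (i , j) with i < j
  edgeList : List (Fin n × Fin n)
  edgeList = concatMap (λ i → map (λ j → (i , j))
                         (filter (λ j → Data.Bool._≟_ (⌊ i <? j ⌋ ∧ adjB i j) true) (allFin n)))
                       (allFin n)

  numEdges : ℕ
  numEdges = length edgeList

  IsRegular : Set
  IsRegular = ∃ λ k → ∀ v → degree v ≡ k

-- vertices of a transformation graph: V(G) ⊎ E(G)
data TVert (n : ℕ) : Set where
  vert : Fin n → TVert n
  edge : Fin n × Fin n → TVert n

module _ {n : ℕ} (G : SimpleGraph n) where

  eqB : Fin n → Fin n → Bool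
  eqB u v = does (u ≟ v)

  vertsMM : List (TVert n)
  vertsMM = map vert (allFin n) ++ map edge (edgeList G)

  adjMM : TVert n → TVert n → Bool
  adjMM (vert u) (vert v) = not (eqB u v) ∧ not (adjB G u v)
  adjMM (vert u) (edge (i , j)) = not (eqB u i) ∧ not (eqB u j)
  adjMM (edge (i , j)) (vert u) = not (eqB u i) ∧ not (eqB u j)
  adjMM (edge _) (edge _) = false

  degreeMM : TVert n → ℕ
  degreeMM x = length (filter (λ y → Data.Bool._≟_ (adjMM x y) true) vertsMM)

  -- Narumi–Katayama index of G^{--}: product of all degrees
  NK-MM : ℕ
  NK-MM = product (map degreeMM vertsMM)

-- Write D u for the degree in G⁻⁻ of a vertex u of G and S for the sum of the D u. Every edge of G has
-- degree n − 2 in G⁻⁻, so NK(G⁻⁻) = (n − 2)^m ∏ D u; and D u + 2 d(u) + 1 = n + m, which with the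
-- handshake lemma gives S = n(n + m − 1) − 4m. The bound is therefore AM–GM for the n naturals n · D u,
-- whose mean is the natural S. AM–GM is proved by smoothing: an entry y below the mean and an entry z
-- above it are replaced by S and y + z − S, which keeps the sum and strictly increases the product.
-- Equality forces all D u, hence all degrees of G, to be equal.

module Submission where

open import Defs
open import Algebra.Properties.CommutativeSemigroup using (interchange)
open import Data.Bool as Bool using (Bool; true; false; not; _∧_)
open import Data.Empty using (⊥-elim)
open import Data.Fin as Fin using (Fin; zero; suc)
import Data.Fin.Properties as Finₚ
open import Data.List using (List; []; _∷_; _++_; length; map; filter; concatMap; allFin)
open import Data.List.Properties using (map-++; map-∘; map-tabulate; length-map; length-tabulate)
open import Data.List.Relation.Binary.Permutation.Propositional using (_↭_; ↭-refl; ↭-trans; prep; swap)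
open import Data.List.Relation.Binary.Permutation.Propositional.Properties using (↭-length)
open import Data.List.Relation.Unary.All as All using (All; []; _∷_)
import Data.List.Relation.Unary.All.Properties as Allₚ
open import Data.Product using (_×_; _,_; proj₁; proj₂; ∃₂)
open import Data.Sum as Sum using (_⊎_; inj₁; inj₂)
open import Function using (_∘_)
open import Function.Bundles using (_⇔_; mk⇔)
open Function.Bundles.Equivalence using (to; from)
open import Function.Construct.Composition using (_⇔-∘_)
open import Level using (Level)
open import Relation.Binary.Definitions using (tri<; tri≈; tri>)
open import Relation.Binary.PropositionalEquality
open import Relation.Nullary using (¬_; yes; no; does)
open import Relation.Nullary.Decidable using (⌊_⌋)
open import Relation.Unary using (Pred; Decidable; ∁)

private
  variable
    a b p : Level
    A B : Set a

module Counting where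

  open import Data.Nat
  open import Data.Nat.ListAction using (sum; product)
  open import Data.Nat.ListAction.Properties using (sum-++)
  open import Data.Nat.Properties

  𝟙 : Bool → ℕ
  𝟙 true = 1
  𝟙 false = 0

  ∑ : (A → ℕ) → List A → ℕ
  ∑ f xs = sum (map f xs)

  syntax ∑ (λ x → e) xs = ∑[ x ∈ xs ] e

  ∑-cong-All : {f g : A → ℕ} {xs : List A} → All (λ x → f x ≡ g x) xs → ∑ f xs ≡ ∑ g xs
  ∑-cong-All [] = refl
  ∑-cong-All (eq ∷ eqs) = cong₂ _+_ eq (∑-cong-All eqs)

  ∑-cong : {f g : A → ℕ} → (∀ x → f x ≡ g x) → ∀ xs → ∑ f xs ≡ ∑ g xs
  ∑-cong f≗g xs = ∑-cong-All (All.universal f≗g xs)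

  ∑-+ : ∀ (f g : A → ℕ) xs → ∑[ x ∈ xs ] (f x + g x) ≡ ∑ f xs + ∑ g xs
  ∑-+ f g [] = refl
  ∑-+ f g (x ∷ xs) = trans (cong (f x + g x +_) (∑-+ f g xs))
                           (interchange +-commutativeSemigroup (f x) (g x) (∑ f xs) (∑ g xs))

  ∑-*ˡ : ∀ c (f : A → ℕ) xs → ∑[ x ∈ xs ] (c * f x) ≡ c * ∑ f xs
  ∑-*ˡ c f [] = sym (*-zeroʳ c)
  ∑-*ˡ c f (x ∷ xs) = trans (cong (c * f x +_) (∑-*ˡ c f xs)) (sym (*-distribˡ-+ c (f x) (∑ f xs)))

  ∑-const : ∀ c (xs : List A) → ∑[ _ ∈ xs ] c ≡ length xs * c
  ∑-const c [] = refl
  ∑-const c (x ∷ xs) = cong (c +_) (∑-const c xs)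

  ∑-++ : ∀ (f : A → ℕ) xs ys → ∑ f (xs ++ ys) ≡ ∑ f xs + ∑ f ys
  ∑-++ f xs ys = trans (cong sum (map-++ f xs ys)) (sum-++ (map f xs) (map f ys))

  ∑-map : ∀ (g : B → ℕ) (f : A → B) xs → ∑ g (map f xs) ≡ ∑ (g ∘ f) xs
  ∑-map g f xs = cong sum (sym (map-∘ xs))

  ∑-concatMap : ∀ (g : B → ℕ) (f : A → List B) xs → ∑ g (concatMap f xs) ≡ ∑[ x ∈ xs ] ∑ g (f x)
  ∑-concatMap g f [] = refl
  ∑-concatMap g f (x ∷ xs) =
    trans (∑-++ g (f x) (concatMap f xs)) (cong (∑ g (f x) +_) (∑-concatMap g f xs))

  ∑-0 : ∀ (xs : List A) → ∑[ _ ∈ xs ] 0 ≡ 0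
  ∑-0 [] = refl
  ∑-0 (x ∷ xs) = ∑-0 xs

  ∑-comm : ∀ (f : A → B → ℕ) xs ys → ∑[ x ∈ xs ] ∑[ y ∈ ys ] f x y ≡ ∑[ y ∈ ys ] ∑[ x ∈ xs ] f x y
  ∑-comm f [] ys = sym (∑-0 ys)
  ∑-comm f (x ∷ xs) ys = trans (cong (∑ (f x) ys +_) (∑-comm f xs ys))
                               (sym (∑-+ (f x) (λ y → ∑[ x ∈ xs ] f x y) ys))

  module _ {P : Pred A p} (P? : Decidable P) where

    ∑-filter : ∀ (g : A → ℕ) xs → ∑ g (filter P? xs) ≡ ∑[ x ∈ xs ] (g x * 𝟙 (does (P? x)))
    ∑-filter g [] = refl
    ∑-filter g (x ∷ xs) with does (P? x)
    ... | true = cong₂ _+_ (sym (*-identityʳ (g x))) (∑-filter g xs)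
    ... | false = trans (∑-filter g xs)
                        (cong (_+ ∑[ y ∈ xs ] (g y * 𝟙 (does (P? y)))) (sym (*-zeroʳ (g x))))

    length-filter : ∀ xs → length (filter P? xs) ≡ ∑[ x ∈ xs ] 𝟙 (does (P? x))
    length-filter [] = refl
    length-filter (x ∷ xs) with does (P? x)
    ... | true = cong suc (length-filter xs)
    ... | false = length-filter xs

  product-All≡ : ∀ {c} xs → All (_≡ c) xs → product xs ≡ c ^ length xs
  product-All≡ [] [] = refl
  product-All≡ (x ∷ xs) (refl ∷ eqs) = cong (x *_) (product-All≡ xs eqs)

  product-map-*ˡ : ∀ c (f : A → ℕ) xs → product (map (λ x → c * f x) xs) ≡ c ^ length xs * product (map f xs)
  product-map-*ˡ c f [] = refl
  product-map-*ˡ c f (x ∷ xs) = trans (cong (c * f x *_) (product-map-*ˡ c f xs))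
    (interchange *-commutativeSemigroup c (f x) (c ^ length xs) (product (map f xs)))

  sum≡0⇒All≡0 : ∀ xs → sum xs ≡ 0 → All (_≡ 0) xs
  sum≡0⇒All≡0 [] _ = []
  sum≡0⇒All≡0 (zero ∷ xs) eq = refl ∷ sum≡0⇒All≡0 xs eq

  _==_ : ∀ {n} → Fin n → Fin n → Bool
  u == v = does (u Fin.≟ v)

  length-allFin : ∀ n → length (allFin n) ≡ n
  length-allFin n = length-tabulate (λ i → i)

  ∑-allFin-suc : ∀ n (f : Fin (suc n) → ℕ) → ∑ f (allFin (suc n)) ≡ f zero + ∑ (f ∘ suc) (allFin n)
  ∑-allFin-suc n f = cong (λ l → f zero + sum l)
    (trans (map-tabulate suc f) (sym (map-tabulate (λ i → i) (f ∘ suc))))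

  ∑-allFin-const : ∀ n c → ∑[ _ ∈ allFin n ] c ≡ n * c
  ∑-allFin-const n c = trans (∑-const c (allFin n)) (cong (_* c) (length-allFin n))

  ∑-select : ∀ {n} (u : Fin n) (h : Fin n → ℕ) → ∑[ v ∈ allFin n ] (𝟙 (u == v) * h v) ≡ h u
  ∑-select {suc n} zero h = begin
    ∑[ v ∈ allFin (suc n) ] (𝟙 (zero == v) * h v)  ≡⟨ ∑-allFin-suc n (λ v → 𝟙 (zero == v) * h v) ⟩
    h zero + 0 + ∑[ v ∈ allFin n ] 0               ≡⟨ cong₂ _+_ (+-identityʳ (h zero)) (∑-0 (allFin n)) ⟩
    h zero + 0                                    ≡⟨ +-identityʳ (h zero) ⟩
    h zero                                        ∎
    where open ≡-Reasoning
  ∑-select {suc n} (suc u) h = trans (∑-allFin-suc n (λ v → 𝟙 (suc u == v) * h v)) (∑-select u (h ∘ suc))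

  ∑-count-≟ : ∀ {n} (u : Fin n) → ∑[ v ∈ allFin n ] 𝟙 (v == u) ≡ 1
  ∑-count-≟ {suc n} zero = trans (∑-allFin-suc n (λ v → 𝟙 (v == zero))) (cong suc (∑-0 (allFin n)))
  ∑-count-≟ {suc n} (suc u) = trans (∑-allFin-suc n (λ v → 𝟙 (v == suc u))) (∑-count-≟ u)

  does-≟-true : ∀ b → does (b Bool.≟ true) ≡ b
  does-≟-true true = refl
  does-≟-true false = refl

module AMGM where

  open import Data.Nat
  open import Data.Nat.ListAction using (sum; product)
  open import Data.Nat.ListAction.Properties using (sum-↭; product-↭)
  open import Data.Nat.Properties
  open import Data.Nat.Tactic.RingSolver using (solve-∀)
  open Counting

  sum≤length* : ∀ {c} xs → All (_≤ c) xs → sum xs ≤ length xs * c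
  sum≤length* [] [] = z≤n
  sum≤length* (x ∷ xs) (x≤c ∷ xs≤c) = +-mono-≤ x≤c (sum≤length* xs xs≤c)

  length*≤sum : ∀ {c} xs → All (c ≤_) xs → length xs * c ≤ sum xs
  length*≤sum [] [] = z≤n
  length*≤sum (x ∷ xs) (c≤x ∷ c≤xs) = +-mono-≤ c≤x (length*≤sum xs c≤xs)

  pick : {P : Pred A p} → Decidable P → ∀ xs → ¬ All (∁ P) xs → ∃₂ λ x xs′ → xs ↭ x ∷ xs′ × P x
  pick P? [] none = ⊥-elim (none [])
  pick P? (x ∷ xs) none with P? x
  ... | yes px = x , xs , ↭-refl , px
  ... | no ¬px with pick P? xs (λ all → none (¬px ∷ all))
  ...   | y , ys , xs↭ , py = y , x ∷ ys , ↭-trans (prep x xs↭) (swap x y ↭-refl) , py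

  exchange : ∀ {y S z} → y < S → S < z → y * z < S * (y + z ∸ S)
  exchange {y} y<S S<z with m≤n⇒∃[o]m+o≡n y<S | m≤n⇒∃[o]m+o≡n S<z
  ... | b , refl | a , refl = begin-strict
      y * z                  <⟨ m<m+n (y * z) z<s ⟩
      y * z + suc a * suc b  ≡⟨ expand y a b ⟩
      S * (suc y + a)        ≡⟨ cong (S *_) (sym (m+n∸n≡m (suc y + a) S)) ⟩
      S * (suc y + a + S ∸ S) ≡⟨ cong (λ t → S * (t ∸ S)) (regroup y a b) ⟩
      S * (y + z ∸ S)        ∎
    where
    open ≤-Reasoning
    S = suc y + b
    z = suc S + a
    expand : ∀ y a b → y * (suc (suc y + b) + a) + suc a * suc b ≡ (suc y + b) * (suc y + a)
    expand = solve-∀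
    regroup : ∀ y a b → suc y + a + (suc y + b) ≡ y + (suc (suc y + b) + a)
    regroup = solve-∀

  partner : ∀ {y S n} ys → length ys ≡ n → y ≢ S → y + sum ys ≡ S + n * S →
            ∃₂ λ z zs → ys ↭ z ∷ zs × S ≤ y + z × y * z < S * (y + z ∸ S)
  partner {y} {S} ys refl y≢S balance with <-cmp y S
  ... | tri≈ _ y≡S _ = ⊥-elim (y≢S y≡S)
  ... | tri< y<S _ _ with pick (S <?_) ys (λ ys≯S →
        <⇒≢ (+-mono-<-≤ y<S (sum≤length* ys (All.map ≮⇒≥ ys≯S))) balance)
  ...   | z , zs , ys↭ , S<z = z , zs , ys↭ , ≤-trans (<⇒≤ S<z) (m≤n+m z y) , exchange y<S S<z
  partner {y} {S} ys refl y≢S balance | tri> _ _ S<y with pick (_<? S) ys (λ ys≮S →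
        <⇒≢ (+-mono-<-≤ S<y (length*≤sum ys (All.map ≮⇒≥ ys≮S))) (sym balance))
  ...   | z , zs , ys↭ , z<S = z , zs , ys↭ , ≤-trans (<⇒≤ S<y) (m≤m+n y z) ,
          subst₂ (λ yz t → yz < S * (t ∸ S)) (*-comm z y) (+-comm z y) (exchange z<S S<y)

  smoothing-< : ∀ {y z w P S t} → 0 < S * t → y * z < S * w → w * P ≤ t → y * (z * P) < S * t
  smoothing-< {y} {z} {w} {zero} {S} {t} St>0 _ _ =
    subst (_< S * t) (sym (trans (cong (y *_) (*-zeroʳ z)) (*-zeroʳ y))) St>0
  smoothing-< {y} {z} {w} {P@(suc _)} {S} {t} _ yz<Sw wP≤t = begin-strict
    y * (z * P)   ≡⟨ *-assoc y z P ⟨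
    y * z * P     <⟨ *-monoˡ-< P yz<Sw ⟩
    S * w * P     ≡⟨ *-assoc S w P ⟩
    S * (w * P)   ≤⟨ *-monoʳ-≤ S wP≤t ⟩
    S * t         ∎
    where open ≤-Reasoning

  smoothed-sum : ∀ {y z w Σzs S nS} → w + S ≡ y + z → y + (z + Σzs) ≡ S + nS → w + Σzs ≡ nS
  smoothed-sum {y} {z} {w} {Σzs} {S} {nS} w+S≡y+z balance = +-cancelʳ-≡ S _ _ (begin
    w + Σzs + S     ≡⟨ +-assoc w Σzs S ⟩
    w + (Σzs + S)   ≡⟨ cong (w +_) (+-comm Σzs S) ⟩
    w + (S + Σzs)   ≡⟨ +-assoc w S Σzs ⟨
    w + S + Σzs     ≡⟨ cong (_+ Σzs) w+S≡y+z ⟩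
    y + z + Σzs     ≡⟨ +-assoc y z Σzs ⟩
    y + (z + Σzs)   ≡⟨ balance ⟩
    S + nS          ≡⟨ +-comm S nS ⟩
    nS + S          ∎)
    where open ≡-Reasoning

  amgm : ∀ n S ys → length ys ≡ n → sum ys ≡ n * S → All (_≡ S) ys ⊎ product ys < S ^ n
  amgm-≤ : ∀ n S ys → length ys ≡ n → sum ys ≡ n * S → product ys ≤ S ^ n

  amgm n zero ys _ Σys = inj₁ (sum≡0⇒All≡0 ys (trans Σys (*-zeroʳ n)))
  amgm zero (suc s) [] _ _ = inj₁ []
  amgm (suc n) S@(suc s) (y ∷ ys) |y∷ys| Σys with y ≟ S
  ... | yes refl = Sum.map (refl ∷_) (*-monoʳ-< S) (amgm n S ys |ys| (+-cancelˡ-≡ S _ _ Σys))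
    where |ys| = suc-injective |y∷ys|
  ... | no y≢S with partner ys (suc-injective |y∷ys|) y≢S Σys
  ...   | z , zs , ys↭ , S≤y+z , yz<Sw =
    inj₂ (subst (λ P → y * P < S ^ suc n) (sym (product-↭ ys↭))
           (smoothing-< {y} {z} {w} {product zs} {S} {S ^ n} (m^n>0 S (suc n)) yz<Sw
                        (amgm-≤ n S (w ∷ zs) |w∷zs| Σw∷zs)))
    where
    w = y + z ∸ S
    |w∷zs| : length (w ∷ zs) ≡ n
    |w∷zs| = suc-injective (trans (cong suc (sym (↭-length ys↭))) |y∷ys|)
    Σw∷zs : w + sum zs ≡ n * S
    Σw∷zs = smoothed-sum {y} {z} {w} {sum zs} (m∸n+n≡m S≤y+z)
                         (trans (cong (y +_) (sym (sum-↭ ys↭))) Σys)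

  amgm-≤ n S ys |ys| Σys = Sum.[ all≡ , <⇒≤ ] (amgm n S ys |ys| Σys)
    where
    all≡ : All (_≡ S) ys → product ys ≤ S ^ n
    all≡ ys≡S = ≤-reflexive (trans (product-All≡ ys ys≡S) (cong (S ^_) |ys|))

module TransformationGraph where

  open import Data.Nat
  open import Data.Nat.ListAction using (sum; product)
  open import Data.Nat.ListAction.Properties using (product-++)
  open import Data.Nat.Properties
  open import Data.Nat.Tactic.RingSolver using (solve-∀)
  open Counting
  open AMGM

  𝟙-outside-edge : ∀ {n} {i j : Fin n} (x : Fin n) → i ≢ j →
                   𝟙 (not (x == i) ∧ not (x == j)) + (𝟙 (x == i) + 𝟙 (x == j)) ≡ 1
  𝟙-outside-edge {i = i} {j} x i≢j with x Fin.≟ i | x Fin.≟ j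
  ... | yes refl | yes refl = ⊥-elim (i≢j refl)
  ... | yes _ | no _ = refl
  ... | no _ | yes _ = refl
  ... | no _ | no _ = refl

  module _ {n} (G : SimpleGraph n) where
    open SimpleGraph G

    adjB-sym : ∀ u v → adjB G u v ≡ adjB G v u
    adjB-sym u v with adj? u v | adj? v u
    ... | yes _ | yes _ = refl
    ... | no _ | no _ = refl
    ... | yes uv | no ¬vu = ⊥-elim (¬vu (symmetric uv))
    ... | no ¬uv | yes vu = ⊥-elim (¬uv (symmetric vu))

    adjB-irrefl : ∀ u → adjB G u u ≡ false
    adjB-irrefl u with adj? u u
    ... | yes uu = ⊥-elim (irreflexive uu)
    ... | no _ = refl

    adj< : Fin n → Fin n → Bool
    adj< i j = ⌊ i Finₚ.<? j ⌋ ∧ adjB G i j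

    adj<⇒< : ∀ i j → adj< i j ≡ true → i Fin.< j
    adj<⇒< i j _ with i Finₚ.<? j
    adj<⇒< i j _ | yes i<j = i<j
    adj<⇒< i j () | no _

    𝟙-adj<-split : ∀ u v → 𝟙 (adj< u v) + 𝟙 (adj< v u) ≡ 𝟙 (adjB G u v)
    𝟙-adj<-split u v with u Finₚ.<? v | v Finₚ.<? u
    ... | yes u<v | yes v<u = ⊥-elim (Finₚ.<-asym u<v v<u)
    ... | yes _ | no _ = +-identityʳ _
    ... | no _ | yes _ = cong 𝟙 (adjB-sym v u)
    ... | no u≮v | no v≮u with refl ← Finₚ.≤-antisym (≮⇒≥ v≮u) (≮⇒≥ u≮v) rewrite adjB-irrefl u = refl

    edgeList-distinct : All (λ e → proj₁ e ≢ proj₂ e) (edgeList G)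
    edgeList-distinct = Allₚ.concat⁺ (Allₚ.map⁺ (All.universal
      (λ i → Allₚ.map⁺ (All.map (λ {j} → Finₚ.<⇒≢ ∘ adj<⇒< i j) (Allₚ.all-filter _ (allFin n))))
      (allFin n)))

    ∑-edgeList : ∀ (g : Fin n × Fin n → ℕ) →
                 ∑ g (edgeList G) ≡ ∑[ i ∈ allFin n ] ∑[ j ∈ allFin n ] (g (i , j) * 𝟙 (adj< i j))
    ∑-edgeList g = trans (∑-concatMap g _ (allFin n)) (∑-cong row (allFin n))
      where
      row : ∀ i → ∑ g (map (i ,_) (filter (λ j → adj< i j Bool.≟ true) (allFin n)))
                ≡ ∑[ j ∈ allFin n ] (g (i , j) * 𝟙 (adj< i j))
      row i = begin
        ∑ g (map (i ,_) (filter (λ j → adj< i j Bool.≟ true) (allFin n)))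
          ≡⟨ ∑-map g (i ,_) (filter (λ j → adj< i j Bool.≟ true) (allFin n)) ⟩
        ∑[ j ∈ filter (λ j → adj< i j Bool.≟ true) (allFin n) ] g (i , j)
          ≡⟨ ∑-filter _ (λ j → g (i , j)) (allFin n) ⟩
        ∑[ j ∈ allFin n ] (g (i , j) * 𝟙 (does (adj< i j Bool.≟ true)))
          ≡⟨ ∑-cong (λ j → cong (λ b → g (i , j) * 𝟙 b) (does-≟-true (adj< i j))) (allFin n) ⟩
        ∑[ j ∈ allFin n ] (g (i , j) * 𝟙 (adj< i j)) ∎
        where open ≡-Reasoning

    degree≡∑ : ∀ u → degree G u ≡ ∑[ v ∈ allFin n ] 𝟙 (adjB G u v)
    degree≡∑ u = length-filter (adj? u) (allFin n)

    incidences : Fin n → ℕ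
    incidences u = ∑[ e ∈ edgeList G ] (𝟙 (u == proj₁ e) + 𝟙 (u == proj₂ e))

    incidences≡degree : ∀ u → incidences u ≡ degree G u
    incidences≡degree u = begin
      incidences u
        ≡⟨ ∑-edgeList (λ e → 𝟙 (u == proj₁ e) + 𝟙 (u == proj₂ e)) ⟩
      ∑[ i ∈ V ] ∑[ j ∈ V ] ((𝟙 (u == i) + 𝟙 (u == j)) * 𝟙 (adj< i j))
        ≡⟨ ∑-cong split-row V ⟩
      ∑[ i ∈ V ] (atFirst i + atSecond i)
        ≡⟨ ∑-+ atFirst atSecond V ⟩
      ∑ atFirst V + ∑ atSecond V
        ≡⟨ cong₂ _+_ (∑-select u (λ i → ∑ (𝟙 ∘ adj< i) V)) (∑-cong (λ i → ∑-select u (𝟙 ∘ adj< i)) V) ⟩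
      ∑[ v ∈ V ] 𝟙 (adj< u v) + ∑[ v ∈ V ] 𝟙 (adj< v u)
        ≡⟨ ∑-+ (𝟙 ∘ adj< u) (λ v → 𝟙 (adj< v u)) V ⟨
      ∑[ v ∈ V ] (𝟙 (adj< u v) + 𝟙 (adj< v u))
        ≡⟨ ∑-cong (𝟙-adj<-split u) V ⟩
      ∑[ v ∈ V ] 𝟙 (adjB G u v)
        ≡⟨ degree≡∑ u ⟨
      degree G u ∎
      where
      open ≡-Reasoning
      V = allFin n

      atFirst atSecond : Fin n → ℕ
      atFirst i = 𝟙 (u == i) * ∑[ j ∈ V ] 𝟙 (adj< i j)
      atSecond i = ∑[ j ∈ V ] (𝟙 (u == j) * 𝟙 (adj< i j))

      split-row : ∀ i → ∑[ j ∈ V ] ((𝟙 (u == i) + 𝟙 (u == j)) * 𝟙 (adj< i j)) ≡ atFirst i + atSecond i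
      split-row i = begin
        ∑[ j ∈ V ] ((𝟙 (u == i) + 𝟙 (u == j)) * 𝟙 (adj< i j))
          ≡⟨ ∑-cong (λ j → *-distribʳ-+ (𝟙 (adj< i j)) (𝟙 (u == i)) (𝟙 (u == j))) V ⟩
        ∑[ j ∈ V ] (𝟙 (u == i) * 𝟙 (adj< i j) + 𝟙 (u == j) * 𝟙 (adj< i j))
          ≡⟨ ∑-+ (λ j → 𝟙 (u == i) * 𝟙 (adj< i j)) (λ j → 𝟙 (u == j) * 𝟙 (adj< i j)) V ⟩
        ∑[ j ∈ V ] (𝟙 (u == i) * 𝟙 (adj< i j)) + atSecond i
          ≡⟨ cong (_+ atSecond i) (∑-*ˡ (𝟙 (u == i)) (𝟙 ∘ adj< i) V) ⟩
        atFirst i + atSecond i ∎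

    handshake : ∑[ u ∈ allFin n ] degree G u ≡ 2 * numEdges G
    handshake = begin
      ∑[ u ∈ V ] degree G u
        ≡⟨ ∑-cong (sym ∘ incidences≡degree) V ⟩
      ∑[ u ∈ V ] incidences u
        ≡⟨ ∑-comm (λ u e → 𝟙 (u == proj₁ e) + 𝟙 (u == proj₂ e)) V (edgeList G) ⟩
      ∑[ e ∈ edgeList G ] ∑[ u ∈ V ] (𝟙 (u == proj₁ e) + 𝟙 (u == proj₂ e))
        ≡⟨ ∑-cong ends (edgeList G) ⟩
      ∑[ _ ∈ edgeList G ] 2
        ≡⟨ ∑-const 2 (edgeList G) ⟩
      numEdges G * 2
        ≡⟨ *-comm (numEdges G) 2 ⟩
      2 * numEdges G ∎
      where
      open ≡-Reasoning
      V = allFin n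
      ends : ∀ e → ∑[ u ∈ V ] (𝟙 (u == proj₁ e) + 𝟙 (u == proj₂ e)) ≡ 2
      ends (i , j) = trans (∑-+ (λ u → 𝟙 (u == i)) (λ u → 𝟙 (u == j)) V)
                           (cong₂ _+_ (∑-count-≟ i) (∑-count-≟ j))

    degreeMM-split : ∀ x → degreeMM G x ≡ ∑[ v ∈ allFin n ] 𝟙 (adjMM G x (vert v))
                                         + ∑[ e ∈ edgeList G ] 𝟙 (adjMM G x (edge e))
    degreeMM-split x = begin
      degreeMM G x
        ≡⟨ length-filter (λ y → adjMM G x y Bool.≟ true) (vertsMM G) ⟩
      ∑[ y ∈ vertsMM G ] 𝟙 (does (adjMM G x y Bool.≟ true))
        ≡⟨ ∑-cong (cong 𝟙 ∘ does-≟-true ∘ adjMM G x) (vertsMM G) ⟩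
      ∑[ y ∈ vertsMM G ] 𝟙 (adjMM G x y)
        ≡⟨ ∑-++ (𝟙 ∘ adjMM G x) (map vert (allFin n)) (map edge (edgeList G)) ⟩
      ∑ (𝟙 ∘ adjMM G x) (map vert (allFin n)) + ∑ (𝟙 ∘ adjMM G x) (map edge (edgeList G))
        ≡⟨ cong₂ _+_ (∑-map (𝟙 ∘ adjMM G x) vert (allFin n)) (∑-map (𝟙 ∘ adjMM G x) edge (edgeList G)) ⟩
      ∑[ v ∈ allFin n ] 𝟙 (adjMM G x (vert v)) + ∑[ e ∈ edgeList G ] 𝟙 (adjMM G x (edge e)) ∎
      where open ≡-Reasoning

    degreeMM-vert : ∀ u → degreeMM G (vert u) + 2 * degree G u + 1 ≡ n + numEdges G
    degreeMM-vert u = begin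
      degreeMM G (vert u) + 2 * degree G u + 1
        ≡⟨ cong (λ d → d + 2 * degree G u + 1) (degreeMM-split (vert u)) ⟩
      nonNeighbours + farEdges + 2 * degree G u + 1
        ≡⟨ regroup nonNeighbours farEdges (degree G u) ⟩
      (nonNeighbours + degree G u + 1) + (farEdges + degree G u)
        ≡⟨ cong₂ _+_ vertex-count edge-count ⟩
      n + numEdges G ∎
      where
      open ≡-Reasoning
      V = allFin n
      nonNeighbours = ∑[ v ∈ V ] 𝟙 (adjMM G (vert u) (vert v))
      farEdges = ∑[ e ∈ edgeList G ] 𝟙 (adjMM G (vert u) (edge e))

      regroup : ∀ a b d → a + b + 2 * d + 1 ≡ (a + d + 1) + (b + d)
      regroup = solve-∀

      -- the factor 1 puts the last summand in the form evaluated by ∑-select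
      trichotomy : ∀ v → 𝟙 (adjMM G (vert u) (vert v)) + 𝟙 (adjB G u v) + 𝟙 (u == v) * 1 ≡ 1
      trichotomy v with u Fin.≟ v
      ... | yes refl rewrite adjB-irrefl u = refl
      ... | no _ with adj? u v
      ...   | yes _ = refl
      ...   | no _ = refl

      vertex-count : nonNeighbours + degree G u + 1 ≡ n
      vertex-count = begin
        nonNeighbours + degree G u + 1
          ≡⟨ cong₂ (λ d o → nonNeighbours + d + o) (degree≡∑ u) (sym (∑-select u (λ _ → 1))) ⟩
        nonNeighbours + ∑[ v ∈ V ] 𝟙 (adjB G u v) + ∑[ v ∈ V ] (𝟙 (u == v) * 1)
          ≡⟨ cong (_+ ∑[ v ∈ V ] (𝟙 (u == v) * 1)) (∑-+ (λ v → 𝟙 (adjMM G (vert u) (vert v))) (𝟙 ∘ adjB G u) V) ⟨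
        ∑[ v ∈ V ] (𝟙 (adjMM G (vert u) (vert v)) + 𝟙 (adjB G u v)) + ∑[ v ∈ V ] (𝟙 (u == v) * 1)
          ≡⟨ ∑-+ (λ v → 𝟙 (adjMM G (vert u) (vert v)) + 𝟙 (adjB G u v)) (λ v → 𝟙 (u == v) * 1) V ⟨
        ∑[ v ∈ V ] (𝟙 (adjMM G (vert u) (vert v)) + 𝟙 (adjB G u v) + 𝟙 (u == v) * 1)
          ≡⟨ ∑-cong trichotomy V ⟩
        ∑[ v ∈ V ] 1
          ≡⟨ trans (∑-allFin-const n 1) (*-identityʳ n) ⟩
        n ∎

      edge-count : farEdges + degree G u ≡ numEdges G
      edge-count = begin
        farEdges + degree G u
          ≡⟨ cong (farEdges +_) (incidences≡degree u) ⟨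
        farEdges + incidences u
          ≡⟨ ∑-+ (λ e → 𝟙 (adjMM G (vert u) (edge e))) (λ e → 𝟙 (u == proj₁ e) + 𝟙 (u == proj₂ e)) (edgeList G) ⟨
        ∑[ e ∈ edgeList G ] (𝟙 (adjMM G (vert u) (edge e)) + (𝟙 (u == proj₁ e) + 𝟙 (u == proj₂ e)))
          ≡⟨ ∑-cong-All (All.map (𝟙-outside-edge u) edgeList-distinct) ⟩
        ∑[ _ ∈ edgeList G ] 1
          ≡⟨ trans (∑-const 1 (edgeList G)) (*-identityʳ (numEdges G)) ⟩
        numEdges G ∎

    degreeMM-edge : ∀ {i j} → i ≢ j → degreeMM G (edge (i , j)) ≡ n ∸ 2
    degreeMM-edge {i} {j} i≢j = begin
      degreeMM G (edge (i , j))
        ≡⟨ degreeMM-split (edge (i , j)) ⟩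
      avoiders + ∑[ _ ∈ edgeList G ] 0
        ≡⟨ cong (avoiders +_) (∑-0 (edgeList G)) ⟩
      avoiders + 0
        ≡⟨ +-identityʳ avoiders ⟩
      avoiders
        ≡⟨ m+n∸n≡m avoiders 2 ⟨
      avoiders + 2 ∸ 2
        ≡⟨ cong (_∸ 2) avoiders+2 ⟩
      n ∸ 2 ∎
      where
      open ≡-Reasoning
      V = allFin n
      avoiders = ∑[ v ∈ V ] 𝟙 (adjMM G (edge (i , j)) (vert v))
      avoiders+2 : avoiders + 2 ≡ n
      avoiders+2 = begin
        avoiders + 2
          ≡⟨ cong (avoiders +_) (cong₂ _+_ (∑-count-≟ i) (∑-count-≟ j)) ⟨
        avoiders + (∑[ v ∈ V ] 𝟙 (v == i) + ∑[ v ∈ V ] 𝟙 (v == j))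
          ≡⟨ cong (avoiders +_) (∑-+ (λ v → 𝟙 (v == i)) (λ v → 𝟙 (v == j)) V) ⟨
        avoiders + ∑[ v ∈ V ] (𝟙 (v == i) + 𝟙 (v == j))
          ≡⟨ ∑-+ (λ v → 𝟙 (adjMM G (edge (i , j)) (vert v))) (λ v → 𝟙 (v == i) + 𝟙 (v == j)) V ⟨
        ∑[ v ∈ V ] (𝟙 (adjMM G (edge (i , j)) (vert v)) + (𝟙 (v == i) + 𝟙 (v == j)))
          ≡⟨ ∑-cong (λ v → 𝟙-outside-edge v i≢j) V ⟩
        ∑[ _ ∈ V ] 1
          ≡⟨ trans (∑-allFin-const n 1) (*-identityʳ n) ⟩
        n ∎

    NK-MM≡ : NK-MM G ≡ product (map (degreeMM G ∘ vert) (allFin n)) * (n ∸ 2) ^ numEdges G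
    NK-MM≡ = begin
      NK-MM G
        ≡⟨ cong product (map-++ (degreeMM G) (map vert V) (map edge E)) ⟩
      product (map (degreeMM G) (map vert V) ++ map (degreeMM G) (map edge E))
        ≡⟨ product-++ (map (degreeMM G) (map vert V)) (map (degreeMM G) (map edge E)) ⟩
      product (map (degreeMM G) (map vert V)) * product (map (degreeMM G) (map edge E))
        ≡⟨ cong₂ (λ vs es → product vs * product es) (map-∘ V) (map-∘ E) ⟨
      product (map (degreeMM G ∘ vert) V) * product (map (degreeMM G ∘ edge) E)
        ≡⟨ cong (product (map (degreeMM G ∘ vert) V) *_) edge-factor ⟩
      product (map (degreeMM G ∘ vert) V) * (n ∸ 2) ^ numEdges G ∎
      where
      open ≡-Reasoning
      V = allFin n
      E = edgeList G
      edge-factor : product (map (degreeMM G ∘ edge) E) ≡ (n ∸ 2) ^ numEdges G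
      edge-factor = trans (product-All≡ _ (Allₚ.map⁺ (All.map degreeMM-edge edgeList-distinct)))
                          (cong ((n ∸ 2) ^_) (length-map (degreeMM G ∘ edge) E))

    ∑degreeMM-vert : ∑[ u ∈ allFin n ] degreeMM G (vert u) + 4 * numEdges G + n ≡ n * (n + numEdges G)
    ∑degreeMM-vert = begin
      ∑ D V + 4 * numEdges G + n
        ≡⟨ cong₂ (λ t o → ∑ D V + t + o) (trans (*-assoc 2 2 (numEdges G)) (cong (2 *_) (sym handshake)))
                                          (sym (trans (∑-allFin-const n 1) (*-identityʳ n))) ⟩
      ∑ D V + 2 * ∑ (degree G) V + ∑[ _ ∈ V ] 1
        ≡⟨ cong (λ t → ∑ D V + t + ∑[ _ ∈ V ] 1) (∑-*ˡ 2 (degree G) V) ⟨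
      ∑ D V + ∑[ u ∈ V ] (2 * degree G u) + ∑[ _ ∈ V ] 1
        ≡⟨ cong (_+ ∑[ _ ∈ V ] 1) (∑-+ D (λ u → 2 * degree G u) V) ⟨
      ∑[ u ∈ V ] (D u + 2 * degree G u) + ∑[ _ ∈ V ] 1
        ≡⟨ ∑-+ (λ u → D u + 2 * degree G u) (λ _ → 1) V ⟨
      ∑[ u ∈ V ] (D u + 2 * degree G u + 1)
        ≡⟨ ∑-cong degreeMM-vert V ⟩
      ∑[ _ ∈ V ] (n + numEdges G)
        ≡⟨ ∑-allFin-const n (n + numEdges G) ⟩
      n * (n + numEdges G) ∎
      where
      open ≡-Reasoning
      V = allFin n
      D = degreeMM G ∘ vert

    degreeMM≡⇔degree≡ : ∀ u v → degreeMM G (vert u) ≡ degreeMM G (vert v) ⇔ degree G u ≡ degree G v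
    degreeMM≡⇔degree≡ u v = mk⇔
      (λ Du≡Dv → *-cancelˡ-≡ (degree G u) (degree G v) 2
                   (+-cancelˡ-≡ (degreeMM G (vert v)) _ _ (subst (λ d → d + 2 * degree G u ≡ _) Du≡Dv balance)))
      (λ du≡dv → +-cancelʳ-≡ (2 * degree G v) _ _ (subst (λ d → degreeMM G (vert u) + 2 * d ≡ _) du≡dv balance))
      where
      balance : degreeMM G (vert u) + 2 * degree G u ≡ degreeMM G (vert v) + 2 * degree G v
      balance = +-cancelʳ-≡ 1 _ _ (trans (degreeMM-vert u) (sym (degreeMM-vert v)))

    ∑degreeMM : ℕ
    ∑degreeMM = ∑[ u ∈ allFin n ] degreeMM G (vert u)

    scaledDegreesMM : List ℕ
    scaledDegreesMM = map (λ u → n * degreeMM G (vert u)) (allFin n)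

    length-scaledDegreesMM : length scaledDegreesMM ≡ n
    length-scaledDegreesMM = trans (length-map _ (allFin n)) (length-allFin n)

    sum-scaledDegreesMM : sum scaledDegreesMM ≡ n * ∑degreeMM
    sum-scaledDegreesMM = ∑-*ˡ n (degreeMM G ∘ vert) (allFin n)

    NK-MM*n^n≡ : NK-MM G * n ^ n ≡ (n ∸ 2) ^ numEdges G * product scaledDegreesMM
    NK-MM*n^n≡ = begin
      NK-MM G * n ^ n
        ≡⟨ cong (_* n ^ n) NK-MM≡ ⟩
      P * c * n ^ n
        ≡⟨ shuffle P c (n ^ n) ⟩
      c * (n ^ n * P)
        ≡⟨ cong (λ l → c * (n ^ l * P)) (length-allFin n) ⟨
      c * (n ^ length (allFin n) * P)
        ≡⟨ cong (c *_) (product-map-*ˡ n (degreeMM G ∘ vert) (allFin n)) ⟨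
      c * product scaledDegreesMM ∎
      where
      open ≡-Reasoning
      P = product (map (degreeMM G ∘ vert) (allFin n))
      c = (n ∸ 2) ^ numEdges G
      shuffle : ∀ P c N → P * c * N ≡ c * (N * P)
      shuffle = solve-∀

    NK-MM-bound : NK-MM G * n ^ n ≤ (n ∸ 2) ^ numEdges G * ∑degreeMM ^ n
    NK-MM-bound = subst (_≤ (n ∸ 2) ^ numEdges G * ∑degreeMM ^ n) (sym NK-MM*n^n≡)
      (*-monoʳ-≤ ((n ∸ 2) ^ numEdges G)
                 (amgm-≤ n ∑degreeMM scaledDegreesMM length-scaledDegreesMM sum-scaledDegreesMM))

  -- The equality case cannot cancel (n − 2)^m when it vanishes, i.e. when n = 2 and G has an edge.
  ∑degreeMM≡0 : ∀ {k} (G : SimpleGraph (suc k)) → (suc k ∸ 2) ^ numEdges G ≡ 0 → ∑degreeMM G ≡ 0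
  ∑degreeMM≡0 {zero} G ()
  ∑degreeMM≡0 {suc zero} G c≡0 with numEdges G | c≡0 | ∑degreeMM-vert G
  ... | suc m | _ | balance = two-vertices (∑degreeMM G) m balance
    where
    two-vertices : ∀ s m → s + 4 * suc m + 2 ≡ 2 * (2 + suc m) → s ≡ 0
    two-vertices s m eq = m+n≡0⇒m≡0 s (+-cancelʳ-≡ (2 * (2 + suc m)) (s + 2 * m) 0 (trans (regroup s m) eq))
      where
      regroup : ∀ s m → s + 2 * m + 2 * (2 + suc m) ≡ s + 4 * suc m + 2
      regroup = solve-∀
  ∑degreeMM≡0 {suc (suc k)} G c≡0 = ⊥-elim (<⇒≢ (m^n>0 (suc k) (numEdges G)) (sym c≡0))

  module _ {k} (G : SimpleGraph (suc k)) where
    private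
      n = suc k

    balanced⇔regular : All (_≡ ∑degreeMM G) (scaledDegreesMM G) ⇔ IsRegular G
    balanced⇔regular = mk⇔ balanced⇒regular regular⇒balanced
      where
      D = degreeMM G ∘ vert

      balanced⇒regular : All (_≡ ∑degreeMM G) (scaledDegreesMM G) → IsRegular G
      balanced⇒regular balanced = degree G zero , λ u →
        to (degreeMM≡⇔degree≡ G u zero) (*-cancelˡ-≡ (D u) (D zero) n (trans (nD≡ u) (sym (nD≡ zero))))
        where
        nD≡ : ∀ u → n * D u ≡ ∑degreeMM G
        nD≡ = Allₚ.tabulate⁻ {f = λ u → u} (Allₚ.map⁻ balanced)

      regular⇒balanced : IsRegular G → All (_≡ ∑degreeMM G) (scaledDegreesMM G)
      regular⇒balanced (d , deg≡d) =
        Allₚ.map⁺ (Allₚ.tabulate⁺ {f = λ u → u} λ u → trans (cong (n *_) (D≡ u)) (sym ∑D≡))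
        where
        D≡ : ∀ u → D u ≡ D zero
        D≡ u = from (degreeMM≡⇔degree≡ G u zero) (trans (deg≡d u) (sym (deg≡d zero)))
        ∑D≡ : ∑degreeMM G ≡ n * D zero
        ∑D≡ = trans (∑-cong D≡ (allFin n)) (∑-allFin-const n (D zero))

    NK-MM-tight : NK-MM G * n ^ n ≡ (n ∸ 2) ^ numEdges G * ∑degreeMM G ^ n ⇔ IsRegular G
    NK-MM-tight = balanced⇔regular ⇔-∘ mk⇔ equal⇒balanced balanced⇒equal
      where
      S = ∑degreeMM G
      ys = scaledDegreesMM G
      c = (n ∸ 2) ^ numEdges G

      balanced⇒equal : All (_≡ S) ys → NK-MM G * n ^ n ≡ c * S ^ n
      balanced⇒equal balanced =
        trans (NK-MM*n^n≡ G)
              (cong (c *_) (trans (product-All≡ ys balanced) (cong (S ^_) (length-scaledDegreesMM G))))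

      equal⇒balanced : NK-MM G * n ^ n ≡ c * S ^ n → All (_≡ S) ys
      equal⇒balanced eq with c ≟ 0
      ... | yes c≡0 = subst (λ t → All (_≡ t) ys) (sym S≡0)
                        (sum≡0⇒All≡0 ys (trans (sum-scaledDegreesMM G) (trans (cong (n *_) S≡0) (*-zeroʳ n))))
        where S≡0 = ∑degreeMM≡0 G c≡0
      ... | no c≢0 with amgm n S ys (length-scaledDegreesMM G) (sum-scaledDegreesMM G)
      ...   | inj₁ balanced = balanced
      ...   | inj₂ product<S^n = ⊥-elim (<-irrefl product≡S^n product<S^n)
        where
        instance _ = ≢-nonZero c≢0
        product≡S^n : product ys ≡ S ^ n
        product≡S^n = *-cancelˡ-≡ _ _ c (trans (sym (NK-MM*n^n≡ G)) eq)

open TransformationGraph using (∑degreeMM; ∑degreeMM-vert; NK-MM-bound; NK-MM-tight)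
import Data.Nat as ℕ
open import Data.Nat using (ℕ; zero; suc; s≤s; z≤n)
open import Data.Integer using (+_; _+_; _-_; _*_; _^_; _≤_; +≤+)
open import Data.Integer.Properties using (pos-+; pos-*; [+m]-[+n]≡m⊖n; ⊖-≥; +-injective)
open import Data.Integer.Tactic.RingSolver using (solve-∀)

pos-^ : ∀ a j → (+ a) ^ j ≡ + (a ℕ.^ j)
pos-^ a zero = refl
pos-^ a (suc j) = trans (cong (+ a *_) (pos-^ a j)) (sym (pos-* a (a ℕ.^ j)))

[n-2]^m≡ : ∀ k (G : SimpleGraph (suc k)) → ((+ suc k) - + 2) ^ numEdges G ≡ + ((suc k ℕ.∸ 2) ℕ.^ numEdges G)
[n-2]^m≡ zero G = refl    -- a graph on one vertex has no edges, and numEdges G computes to 0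
[n-2]^m≡ (suc k) G =
  trans (cong (_^ numEdges G) (trans ([+m]-[+n]≡m⊖n (suc (suc k)) 2) (⊖-≥ (s≤s (s≤s z≤n)))))
        (pos-^ k (numEdges G))

∑degreeMM-ℤ : ∀ {n} (G : SimpleGraph n) →
              (+ n) * ((+ n) + (+ numEdges G) - + 1) - + 4 * + numEdges G ≡ + ∑degreeMM G
∑degreeMM-ℤ {n} G = rearrange (+ ∑degreeMM G) (+ numEdges G) (+ n) lifted
  where
  m = numEdges G
  S = ∑degreeMM G

  lifted : + S + + 4 * + m + + n ≡ + n * (+ n + + m)
  lifted = begin
    + S + + 4 * + m + + n          ≡⟨ cong (λ t → + S + t + + n) (pos-* 4 m) ⟨
    + S + + (4 ℕ.* m) + + n        ≡⟨ cong (_+ + n) (pos-+ S (4 ℕ.* m)) ⟨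
    + (S ℕ.+ 4 ℕ.* m) + + n        ≡⟨ pos-+ (S ℕ.+ 4 ℕ.* m) n ⟨
    + (S ℕ.+ 4 ℕ.* m ℕ.+ n)        ≡⟨ cong +_ (∑degreeMM-vert G) ⟩
    + (n ℕ.* (n ℕ.+ m))            ≡⟨ pos-* n (n ℕ.+ m) ⟩
    + n * + (n ℕ.+ m)              ≡⟨ cong (+ n *_) (pos-+ n m) ⟩
    + n * (+ n + + m)              ∎
    where open ≡-Reasoning

  rearrange : ∀ s m n → s + + 4 * m + n ≡ n * (n + m) → n * (n + m - + 1) - + 4 * m ≡ s
  rearrange s m n eq = begin
    n * (n + m - + 1) - + 4 * m     ≡⟨ expand n m ⟩
    n * (n + m) - n - + 4 * m       ≡⟨ cong (λ t → t - n - + 4 * m) eq ⟨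
    s + + 4 * m + n - n - + 4 * m   ≡⟨ cancel s m n ⟩
    s                               ∎
    where
    open ≡-Reasoning
    expand : ∀ n m → n * (n + m - + 1) - + 4 * m ≡ n * (n + m) - n - + 4 * m
    expand = solve-∀
    cancel : ∀ s m n → s + + 4 * m + n - n - + 4 * m ≡ s
    cancel = solve-∀

theorem5 : (k : ℕ) → (G : SimpleGraph (suc k)) →
    let n = suc k
        m = numEdges G
        lhs = + NK-MM G * (+ n) ^ n
        rhs = ((+ n) - + 2) ^ m * ((+ n) * ((+ n) + (+ m) - + 1) - + 4 * + m) ^ n
    in (lhs ≤ rhs) × ((lhs ≡ rhs) ⇔ IsRegular G)
theorem5 k G = subst₂ _≤_ (sym lhs≡) (sym rhs≡) (+≤+ (NK-MM-bound G))
             , mk⇔ (λ eq → to (NK-MM-tight G) (+-injective (trans (sym lhs≡) (trans eq rhs≡))))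
                   (λ regular → trans lhs≡ (trans (cong +_ (from (NK-MM-tight G) regular)) (sym rhs≡)))
  where
  n = suc k
  m = numEdges G
  lhs≡ : + NK-MM G * (+ n) ^ n ≡ + (NK-MM G ℕ.* n ℕ.^ n)
  lhs≡ = trans (cong (+ NK-MM G *_) (pos-^ n n)) (sym (pos-* (NK-MM G) (n ℕ.^ n)))
  rhs≡ : ((+ n) - + 2) ^ m * ((+ n) * ((+ n) + (+ m) - + 1) - + 4 * + m) ^ n
         ≡ + ((n ℕ.∸ 2) ℕ.^ m ℕ.* ∑degreeMM G ℕ.^ n)
  rhs≡ = trans (cong₂ _*_ ([n-2]^m≡ k G) (trans (cong (_^ n) (∑degreeMM-ℤ G)) (pos-^ (∑degreeMM G) n)))
               (sym (pos-* ((n ℕ.∸ 2) ℕ.^ m) (∑degreeMM G ℕ.^ n)))
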